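{- Let $\varepsilon\colon X^{\times}_{\mathrm{irr}}\to\mathcal{P}(M)$ be a map. For $X'\subseteq X$ and $M'\subseteq M$ let $\varepsilon'\colon X'^{\times}_{\mathrm{irr}}\to\mathcal{P}(M')$ be given by $\varepsilon'(x,y)=\varepsilon(x,y)\cap M'$. Then $\varepsilon$ is a Fitch map if and only if all of the following hold: (a) if $|M|\ge2$ and $|X|\ge4$, then for every 4-element $X'\subseteq X$ and every 2-element $M'\subseteq M$ the map $\varepsilon'$ is a Fitch map; (b) if $|M|\ge2$ and $|X|\le3$, then for every 2-element $M'\subseteq M$ the map $\varepsilon'$ with $X'=X$ is a Fitch map; (c) if $|M|=1$, then for every 3-element $X'\subseteq X$ the map $\varepsilon'$ with $M'=M$ is a Fitch map.
   Context: $X$ is a finite nonempty set, $M$ a finite nonempty set of colors, $X^{\times}_{\mathrm{irr}}=\{(x,y)\in X\times X: x\neq y\}$. A phylogenetic tree on $X$ is a rooted tree whose leaves (non-root vertices of degree $1$) form $X$, whose root has degree $\ge2$ and whose non-root inner vertices have degree $\ge3$; $\mathrm{lca}(x,y)$ is the last common ancestor. An edge-labeled tree $(T,\lambda)$ on $X$ with $M$ is a phylogenetic tree $T$ on $X$ with $\lambda\colon E(T)\to\mathcal{P}(M)$; $e$ is an $m$-edge if $m\in\lambda(e)$. $(T,\lambda)$ explains $\varepsilon$ if for all $(x,y)\in X^{\times}_{\mathrm{irr}}$, $m\in M$: $m\in\varepsilon(x,y)$ iff the path from $\mathrm{lca}(x,y)$ to $y$ contains an $m$-edge; $\varepsilon$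 is a Fitch map if some edge-labeled tree explains it (the same definition applies to $\varepsilon'$ with $X',M'$ in place of $X,M$). -}

module Defs where

open import Data.Nat using (ℕ; suc; _≤_)
open import Data.Bool using (Bool; true)
open import Data.Empty using (⊥)
open import Data.Unit using (⊤)
open import Data.Product using (Σ; _×_; _,_; proj₁)
open import Data.Sum using (_⊎_)
open import Data.List using (List; []; _∷_; [_]; _++_; length)
open import Data.List.Membership.Propositional using (_∈_)
open import Data.List.Relation.Unary.Unique.Propositional using (Unique)
open import Data.Fin using (Fin)
open import Data.Fin.Subset as S using (Subset)
open import Relation.Binary.PropositionalEquality using (_≡_; _≢_)
open import Relation.Nullary using (¬_)
open import Function.Bundles using (_⇔_)

Pow : Set → Set
Pow M = M → Bool

-- Rooted trees with leaves labelled by X and edges (parent → child) labelled by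
-- subsets of M.  Each child of an inner vertex comes with the label of the edge to it.
data Tree (X M : Set) : Set where
  leaf : X → Tree X M
  node : List (Pow M × Tree X M) → Tree X M

module _ {X M : Set} where

  mutual
    leaves : Tree X M → List X
    leaves (leaf x)  = [ x ]
    leaves (node cs) = leavesL cs

    leavesL : List (Pow M × Tree X M) → List X
    leavesL []             = []
    leavesL ((_ , t) ∷ cs) = leaves t ++ leavesL cs

  mutual
    -- phylogenetic: every inner vertex has at least two children
    -- (root degree ≥ 2, non-root inner vertices degree ≥ 3)
    Phylo : Tree X M → Set
    Phylo (leaf _)  = ⊤
    Phylo (node cs) = (2 ≤ length cs) × PhyloL cs

    PhyloL : List (Pow M × Tree X M) → Set
    PhyloL []             = ⊤
    PhyloL ((_ , t) ∷ cs) = Phylo t × PhyloL cs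

  mutual
    Below : M → X → Tree X M → Set
    Below m y (leaf _)  = ⊥
    Below m y (node cs) = BelowL m y cs

    BelowL : M → X → List (Pow M × Tree X M) → Set
    BelowL m y []             = ⊥
    BelowL m y ((l , t) ∷ cs) = (y ∈ leaves t × (l m ≡ true ⊎ Below m y t)) ⊎ BelowL m y cs

  mutual
    -- the path from lca(x,y) to the leaf y contains an m-edge:
    -- either x and y lie in a common child subtree (recurse), or the current
    -- vertex is lca(x,y): then take the child edge towards y (whose subtree
    -- does not contain x) and the path below it to y.
    LcaPath : M → X → X → Tree X M → Set
    LcaPath m x y (leaf _)  = ⊥
    LcaPath m x y (node cs) = LcaPathL m x y cs ⊎ SplitL m x y cs

    LcaPathL : M → X → X → List (Pow M × Tree X M) → Set
    LcaPathL m x y []             = ⊥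
    LcaPathL m x y ((_ , t) ∷ cs) =
      (x ∈ leaves t × y ∈ leaves t × LcaPath m x y t) ⊎ LcaPathL m x y cs

    SplitL : M → X → X → List (Pow M × Tree X M) → Set
    SplitL m x y []             = ⊥
    SplitL m x y ((l , t) ∷ cs) =
      (y ∈ leaves t × ¬ (x ∈ leaves t) × (l m ≡ true ⊎ Below m y t)) ⊎ SplitL m x y cs

Explains : {X M : Set} → (X → X → Pow M) → Tree X M → Set
Explains {X} {M} ε T = ∀ (x y : X) → x ≢ y → ∀ (m : M) → (ε x y m ≡ true) ⇔ LcaPath m x y T

IsFitch : {X M : Set} → (X → X → Pow M) → Set
IsFitch {X} {M} ε =
  Σ (Tree X M) λ T → Phylo T × (∀ (x : X) → x ∈ leaves T) × Unique (leaves T) × Explains ε T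

Elem : {n : ℕ} → Subset n → Set
Elem {n} A = Σ (Fin n) (λ x → x S.∈ A)

restrict : {n k : ℕ} (X' : Subset n) (M' : Subset k) →
           (Fin n → Fin n → Pow (Fin k)) → Elem X' → Elem X' → Pow (Elem M')
restrict X' M' ε (x , _) (y , _) (m , _) = ε x y m

module Submission where

-- For a colour m and a leaf y let N_m(y) consist of y and all x with m ∉ ε(x,y).  If a
-- tree explains ε, then N_m(y) is the set of leaves below the lowest m-edge above y (all
-- leaves if there is none).  Hence y ∈ N_m(z) implies N_m(y) ⊆ N_m(z), and any two of
-- these sets that meet are nested.  Conversely, from these two properties a tree can be
-- rebuilt: split the leaves into the union of the proper neighbourhoods around one leaf
-- and the rest, recurse on both parts, and put m on the edge above a part exactly when
-- the part is some N_m(z).  Both properties pass to restrictions of ε, and both are local: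
-- transitivity involves three points and one colour, and two overlapping neighbourhoods
-- already overlap on four points (with a single colour, on three).

open import Defs
open import Data.Bool using (true; false) renaming (_≟_ to _≟ᵇ_)
open import Data.Bool.Properties using (¬-not; not-¬)
open import Data.Empty using (⊥-elim)
open import Data.Fin using (Fin; zero; suc)
import Data.Fin.Properties as Fin
open import Data.Fin.Subset using (Subset; inside; outside; ∣_∣; ⊤; ⁅_⁆; _∪_; _⊆_) renaming (_∈_ to _∈ₛ_; ⊥ to ∅)
open import Data.Fin.Subset.Properties using (∣⊥∣≡0; ∣⁅x⁆∣≡1; ∣⊤∣≡n; p⊆p∪q; q⊆p∪q; x∈⁅x⁆; in⊆in; out⊆; ⊆⊤; ∈⊤)
open import Data.List as List using (List; []; _∷_; [_]; _++_; length; filter)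
open import Data.List.Membership.Propositional using (_∈_; _∉_; find; lose)
open import Data.List.Membership.Propositional.Properties
  using (∈-++⁺ˡ; ∈-++⁺ʳ; ∈-++⁻; ∈-filter⁺; ∈-filter⁻; ∈-map⁺; ∈-allFin)
open import Data.List.Properties using (filter-notAll; ++-identityʳ)
open import Data.List.Relation.Binary.Disjoint.Propositional using (Disjoint)
open import Data.List.Relation.Unary.All as All using (All; []; _∷_)
import Data.List.Relation.Unary.All.Properties as Allₚ
open import Data.List.Relation.Unary.AllPairs using ([]; _∷_)
open import Data.List.Relation.Unary.Any as Any using (Any; here; there)
open import Data.List.Relation.Unary.Unique.Propositional using (Unique)
import Data.List.Relation.Unary.Unique.Propositional.Properties as Uniqueₚ
open import Data.Nat using (ℕ; zero; suc; _+_; _≤_; s≤s; z≤n)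
import Data.Nat.Properties as ℕ
open import Data.Product using (Σ; ∃; ∃-syntax; _×_; _,_; proj₁; proj₂)
open import Data.Sum as Sum using (_⊎_; inj₁; inj₂)
open import Data.Vec using ([]; _∷_; here; there)
open import Data.Vec.Properties.WithK using ([]=-irrelevant)
open import Function using (_∘_; id)
open import Function.Bundles using (_⇔_; mk⇔; Equivalence)
import Function.Properties.Equivalence as ⇔
open import Level using (0ℓ)
open import Relation.Binary.Definitions using (DecidableEquality)
open import Relation.Binary.PropositionalEquality using (_≡_; _≢_; refl; sym; trans; cong; subst)
import Relation.Binary.Reasoning.Setoid
open import Relation.Nullary using (¬_; Dec; yes; no; does)
import Relation.Nullary.Decidable as Dec
open import Relation.Unary using (Decidable)

open Equivalence using (to; from)

module ⇔-Reasoning = Relation.Binary.Reasoning.Setoid (⇔.⇔-setoid 0ℓ)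

module _ {A : Set} where

  Unique-++⁻ˡ : (xs : List A) {ys : List A} → Unique (xs ++ ys) → Unique xs
  Unique-++⁻ˡ []       _            = []
  Unique-++⁻ˡ (x ∷ xs) (x∉ ∷ uniq) = Allₚ.++⁻ˡ xs x∉ ∷ Unique-++⁻ˡ xs uniq

  Unique-++⁻ʳ : (xs : List A) {ys : List A} → Unique (xs ++ ys) → Unique ys
  Unique-++⁻ʳ []       uniq       = uniq
  Unique-++⁻ʳ (_ ∷ xs) (_ ∷ uniq) = Unique-++⁻ʳ xs uniq

  Unique-++⇒Disjoint : (xs : List A) {ys : List A} → Unique (xs ++ ys) → Disjoint xs ys
  Unique-++⇒Disjoint (x ∷ xs) (x∉ ∷ _)    (here refl , v∈ys)  = All.lookup x∉ (∈-++⁺ʳ xs v∈ys) refl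
  Unique-++⇒Disjoint (x ∷ xs) (_ ∷ uniq) (there v∈xs , v∈ys) = Unique-++⇒Disjoint xs uniq (v∈xs , v∈ys)

  ∃∈? : {P : A → Set} → Decidable P → (xs : List A) → Dec (∃[ x ] x ∈ xs × P x)
  ∃∈? P? xs = Dec.map′ find (λ (_ , x∈ , px) → lose x∈ px) (Any.any? P? xs)

  module _ {xs : List A} (complete : ∀ x → x ∈ xs) {P : A → Set} (P? : Decidable P) where

    ∃?-complete : Dec (∃ P)
    ∃?-complete = Dec.map′ (λ (x , _ , px) → x , px) (λ (x , px) → x , complete x , px) (∃∈? P? xs)

    ∀?-complete : Dec (∀ {x} → P x)
    ∀?-complete = Dec.map′ (λ ps {x} → All.lookup ps (complete x)) (λ ∀p → All.tabulate (λ _ → ∀p)) (All.all? P? xs)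

dec-true⁻ : ∀ {P : Set} (P? : Dec P) → does P? ≡ true → P
dec-true⁻ (yes p) _ = p

Branch : Set → Set → Set
Branch X M = Pow M × Tree X M

module _ {X M : Set} where

  module _ (P : Tree X M → Set) (P-leaf : ∀ x → P (leaf x))
           (P-node : ∀ cs → (∀ {l t} → (l , t) ∈ cs → P t) → P (node cs)) where

    mutual
      tree-ind : ∀ t → P t
      tree-ind (leaf x)  = P-leaf x
      tree-ind (node cs) = P-node cs (branch-ind cs)

      branch-ind : ∀ cs {l t} → (l , t) ∈ cs → P t
      branch-ind ((_ , t) ∷ _) (here refl) = tree-ind t
      branch-ind (_ ∷ cs)      (there b∈)  = branch-ind cs b∈

  leavesL⁺ : ∀ {cs : List (Branch X M)} {l t y} → (l , t) ∈ cs → y ∈ leaves t → y ∈ leavesL cs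
  leavesL⁺ {(_ , t) ∷ _}  (here refl) y∈ = ∈-++⁺ˡ y∈
  leavesL⁺ {(_ , t) ∷ cs} (there b∈)  y∈ = ∈-++⁺ʳ (leaves t) (leavesL⁺ b∈ y∈)

  leavesL⁻ : ∀ (cs : List (Branch X M)) {y} → y ∈ leavesL cs → ∃[ l ] ∃[ t ] (l , t) ∈ cs × y ∈ leaves t
  leavesL⁻ ((l , t) ∷ cs) y∈ with ∈-++⁻ (leaves t) y∈
  ... | inj₁ y∈t  = l , t , here refl , y∈t
  ... | inj₂ y∈cs = let l′ , t′ , b∈ , y∈t′ = leavesL⁻ cs y∈cs in l′ , t′ , there b∈ , y∈t′

  Unique-branch : ∀ {cs : List (Branch X M)} {l t} → Unique (leavesL cs) → (l , t) ∈ cs → Unique (leaves t)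
  Unique-branch {(_ , t) ∷ _}  uniq (here refl) = Unique-++⁻ˡ (leaves t) uniq
  Unique-branch {(_ , t) ∷ _}  uniq (there b∈)  = Unique-branch (Unique-++⁻ʳ (leaves t) uniq) b∈

  branch-unique : ∀ {cs : List (Branch X M)} {b b′ y} → Unique (leavesL cs) → b ∈ cs → b′ ∈ cs →
                  y ∈ leaves (proj₂ b) → y ∈ leaves (proj₂ b′) → b ≡ b′
  branch-unique {(_ , t) ∷ _} uniq (here refl) (here refl) _   _    = refl
  branch-unique {(_ , t) ∷ _} uniq (here refl) (there b∈)  y∈t y∈t′ =
    ⊥-elim (Unique-++⇒Disjoint (leaves t) uniq (y∈t , leavesL⁺ b∈ y∈t′))
  branch-unique {(_ , t) ∷ _} uniq (there b∈)  (here refl) y∈t′ y∈t =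
    ⊥-elim (Unique-++⇒Disjoint (leaves t) uniq (y∈t , leavesL⁺ b∈ y∈t′))
  branch-unique {(_ , t) ∷ _} uniq (there b∈)  (there b∈′) y∈t y∈t′ =
    branch-unique (Unique-++⁻ʳ (leaves t) uniq) b∈ b∈′ y∈t y∈t′

  Below⁺ : M → X → Branch X M → Set
  Below⁺ m y (l , t) = l m ≡ true ⊎ Below m y t

  module _ (m : M) (x y : X) where

    LcaInBranch : Branch X M → Set
    LcaInBranch (_ , t) = x ∈ leaves t × y ∈ leaves t × LcaPath m x y t

    SplitAtBranch : Branch X M → Set
    SplitAtBranch b = y ∈ leaves (proj₂ b) × x ∉ leaves (proj₂ b) × Below⁺ m y b

    LcaPathL⇔Any : ∀ cs → LcaPathL m x y cs ⇔ Any LcaInBranch cs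
    LcaPathL⇔Any cs = mk⇔ (⇒ cs) (⇐ cs)
      where
      ⇒ : ∀ cs → LcaPathL m x y cs → Any LcaInBranch cs
      ⇒ (_ ∷ _)  (inj₁ p) = here p
      ⇒ (_ ∷ cs) (inj₂ p) = there (⇒ cs p)
      ⇐ : ∀ cs → Any LcaInBranch cs → LcaPathL m x y cs
      ⇐ (_ ∷ _)  (here p)  = inj₁ p
      ⇐ (_ ∷ cs) (there p) = inj₂ (⇐ cs p)

    SplitL⇔Any : ∀ cs → SplitL m x y cs ⇔ Any SplitAtBranch cs
    SplitL⇔Any cs = mk⇔ (⇒ cs) (⇐ cs)
      where
      ⇒ : ∀ cs → SplitL m x y cs → Any SplitAtBranch cs
      ⇒ (_ ∷ _)  (inj₁ p) = here p
      ⇒ (_ ∷ cs) (inj₂ p) = there (⇒ cs p)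
      ⇐ : ∀ cs → Any SplitAtBranch cs → SplitL m x y cs
      ⇐ (_ ∷ _)  (here p)  = inj₁ p
      ⇐ (_ ∷ cs) (there p) = inj₂ (⇐ cs p)

  module _ (m : M) (y : X) where

    BelowBranch : Branch X M → Set
    BelowBranch b = y ∈ leaves (proj₂ b) × Below⁺ m y b

    BelowL⇔Any : ∀ cs → BelowL m y cs ⇔ Any BelowBranch cs
    BelowL⇔Any cs = mk⇔ (⇒ cs) (⇐ cs)
      where
      ⇒ : ∀ cs → BelowL m y cs → Any BelowBranch cs
      ⇒ (_ ∷ _)  (inj₁ p) = here p
      ⇒ (_ ∷ cs) (inj₂ p) = there (⇒ cs p)
      ⇐ : ∀ cs → Any BelowBranch cs → BelowL m y cs
      ⇐ (_ ∷ _)  (here p)  = inj₁ p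
      ⇐ (_ ∷ cs) (there p) = inj₂ (⇐ cs p)

  any-at-branch : ∀ {P : Branch X M → Set} {cs b y} → Unique (leavesL cs) → b ∈ cs → y ∈ leaves (proj₂ b) →
                  (∀ {b′} → P b′ → y ∈ leaves (proj₂ b′)) → Any P cs → P b
  any-at-branch uniq b∈ y∈ P⇒y∈ p with find p
  ... | b′ , b′∈ , pb′ with branch-unique uniq b∈ b′∈ y∈ (P⇒y∈ pb′)
  ... | refl = pb′

  module _ {cs : List (Branch X M)} {l : Pow M} {t : Tree X M} (uniq : Unique (leavesL cs))
           (b∈ : (l , t) ∈ cs) {m : M} {y : X} (y∈ : y ∈ leaves t) where

    below-node⇔branch : Below m y (node cs) ⇔ Below⁺ m y (l , t)
    below-node⇔branch = mk⇔
      (proj₂ ∘ any-at-branch uniq b∈ y∈ proj₁ ∘ to (BelowL⇔Any m y cs))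
      (λ b → from (BelowL⇔Any m y cs) (lose b∈ (y∈ , b)))

    lcaPath-node⇔branch : ∀ {x} → x ∈ leaves t → LcaPath m x y (node cs) ⇔ LcaPath m x y t
    lcaPath-node⇔branch {x} x∈ = mk⇔ ⇒ (λ p → inj₁ (from (LcaPathL⇔Any m x y cs) (lose b∈ (x∈ , y∈ , p))))
      where
      ⇒ : LcaPath m x y (node cs) → LcaPath m x y t
      ⇒ (inj₁ p) = proj₂ (proj₂ (any-at-branch uniq b∈ y∈ (proj₁ ∘ proj₂) (to (LcaPathL⇔Any m x y cs) p)))
      ⇒ (inj₂ p) = ⊥-elim (proj₁ (proj₂ (any-at-branch uniq b∈ y∈ proj₁ (to (SplitL⇔Any m x y cs) p))) x∈)

    lcaPath-node⇔below⁺ : ∀ {x} → x ∉ leaves t → LcaPath m x y (node cs) ⇔ Below⁺ m y (l , t)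
    lcaPath-node⇔below⁺ {x} x∉ = mk⇔ ⇒ (λ b → inj₂ (from (SplitL⇔Any m x y cs) (lose b∈ (y∈ , x∉ , b))))
      where
      ⇒ : LcaPath m x y (node cs) → Below⁺ m y (l , t)
      ⇒ (inj₁ p) = ⊥-elim (x∉ (proj₁ (any-at-branch uniq b∈ y∈ (proj₁ ∘ proj₂) (to (LcaPathL⇔Any m x y cs) p))))
      ⇒ (inj₂ p) = proj₂ (proj₂ (any-at-branch uniq b∈ y∈ proj₁ (to (SplitL⇔Any m x y cs) p)))

  module _ (m : M) where

    mutual
      lcaPath⇒below : ∀ {x y : X} t → LcaPath m x y t → Below m y t
      lcaPath⇒below (node cs) (inj₁ p) = lcaPathL⇒belowL cs p
      lcaPath⇒below (node cs) (inj₂ p) = splitL⇒belowL cs p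

      lcaPathL⇒belowL : ∀ {x y} cs → LcaPathL m x y cs → BelowL m y cs
      lcaPathL⇒belowL ((_ , t) ∷ _)  (inj₁ (_ , y∈ , p)) = inj₁ (y∈ , inj₂ (lcaPath⇒below t p))
      lcaPathL⇒belowL (_ ∷ cs)       (inj₂ p)            = inj₂ (lcaPathL⇒belowL cs p)

      splitL⇒belowL : ∀ {x y} cs → SplitL m x y cs → BelowL m y cs
      splitL⇒belowL (_ ∷ _)  (inj₁ (y∈ , _ , b)) = inj₁ (y∈ , b)
      splitL⇒belowL (_ ∷ cs) (inj₂ p)            = inj₂ (splitL⇒belowL cs p)

module _ {X M : Set} (N : M → X → X → Set) where

  Overlap : M → X → M → X → X → X → X → Set
  Overlap m y m′ y′ a b c = N m y a × N m′ y′ a × N m y b × ¬ N m′ y′ b × ¬ N m y c × N m′ y′ c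

module TreeNeighbourhoods {X M : Set} (_≟_ : DecidableEquality X) where

  open import Data.List.Membership.DecPropositional _≟_ using (_∈?_)

  TreeNbhd : Tree X M → M → X → X → Set
  TreeNbhd t m y x = x ≡ y ⊎ ¬ LcaPath m x y t

  module _ {cs : List (Branch X M)} {l : Pow M} {t : Tree X M} (uniq : Unique (leavesL cs))
           (b∈ : (l , t) ∈ cs) {m : M} {y : X} (y∈ : y ∈ leaves t) where

    lcaPath-node⇒below⁺ : ∀ {x} → LcaPath m x y (node cs) → Below⁺ m y (l , t)
    lcaPath-node⇒below⁺ {x} p with x ∈? leaves t
    ... | yes x∈ = inj₂ (lcaPath⇒below m t (to (lcaPath-node⇔branch uniq b∈ y∈ x∈) p))
    ... | no x∉  = to (lcaPath-node⇔below⁺ uniq b∈ y∈ x∉) p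

    treeNbhd-node⇔branch : ∀ {x} → x ∈ leaves t → TreeNbhd (node cs) m y x ⇔ TreeNbhd t m y x
    treeNbhd-node⇔branch x∈ = mk⇔
      (Sum.map₂ (_∘ from (lcaPath-node⇔branch uniq b∈ y∈ x∈)))
      (Sum.map₂ (_∘ to (lcaPath-node⇔branch uniq b∈ y∈ x∈)))

    -- Some w outside N_m(y) forces an m-edge on the way down to y inside the branch,
    -- so N_m(y) cannot leave the branch.
    treeNbhd⊆branch : ∀ {w x} → ¬ TreeNbhd (node cs) m y w → TreeNbhd (node cs) m y x → x ∈ leaves t
    treeNbhd⊆branch {x = x} ¬yw yx with x ∈? leaves t
    ... | yes x∈ = x∈
    ... | no x∉ with yx
    ...   | inj₁ refl = ⊥-elim (x∉ y∈)
    ...   | inj₂ ¬xy  =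
      ⊥-elim (¬yw (inj₂ (¬xy ∘ from (lcaPath-node⇔below⁺ uniq b∈ y∈ x∉) ∘ lcaPath-node⇒below⁺)))

  below-shared : ∀ t → Unique (leaves t) → ∀ {m y z} → z ∈ leaves t → Below m z t → ¬ LcaPath m y z t → Below m y t
  below-shared = tree-ind P (λ _ _ _ ()) step
    where
    P : Tree X M → Set
    P t = Unique (leaves t) → ∀ {m y z} → z ∈ leaves t → Below m z t → ¬ LcaPath m y z t → Below m y t
    step : ∀ cs → (∀ {l t} → (l , t) ∈ cs → P t) → P (node cs)
    step cs ih uniq {m} {y} {z} z∈ bz ¬yz with leavesL⁻ cs z∈
    ... | l , t , b∈ , z∈t with y ∈? leaves t
    ...   | no y∉  = ⊥-elim (¬yz (from (lcaPath-node⇔below⁺ uniq b∈ z∈t y∉) (to (below-node⇔branch uniq b∈ z∈t) bz)))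
    ...   | yes y∈ = from (below-node⇔branch uniq b∈ y∈) (shift (to (below-node⇔branch uniq b∈ z∈t) bz))
      where
      shift : Below⁺ m z (l , t) → Below⁺ m y (l , t)
      shift (inj₁ lm) = inj₁ lm
      shift (inj₂ bz) = inj₂ (ih b∈ (Unique-branch uniq b∈) z∈t bz (¬yz ∘ from (lcaPath-node⇔branch uniq b∈ z∈t y∈)))

  below⁺-shared : ∀ {l t} → Unique (leaves t) → ∀ {m y z} → z ∈ leaves t →
                  Below⁺ m z (l , t) → ¬ LcaPath m y z t → Below⁺ m y (l , t)
  below⁺-shared _    _  (inj₁ lm) _   = inj₁ lm
  below⁺-shared uniq z∈ (inj₂ bz) ¬yz = inj₂ (below-shared _ uniq z∈ bz ¬yz)

  ¬lcaPath-trans : ∀ t → Unique (leaves t) → ∀ {m x y z} → z ∈ leaves t →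
                   ¬ LcaPath m y z t → ¬ LcaPath m x y t → ¬ LcaPath m x z t
  ¬lcaPath-trans = tree-ind P (λ _ _ _ _ _ ()) step
    where
    P : Tree X M → Set
    P t = Unique (leaves t) → ∀ {m x y z} → z ∈ leaves t → ¬ LcaPath m y z t → ¬ LcaPath m x y t → ¬ LcaPath m x z t
    step : ∀ cs → (∀ {l t} → (l , t) ∈ cs → P t) → P (node cs)
    step cs ih uniq {m} {x} {y} {z} z∈ ¬yz ¬xy xz with leavesL⁻ cs z∈
    ... | l , t , b∈ , z∈t with y ∈? leaves t | x ∈? leaves t
    ...   | no y∉  | _      = ¬yz (from (lcaPath-node⇔below⁺ uniq b∈ z∈t y∉) (lcaPath-node⇒below⁺ uniq b∈ z∈t xz))
    ...   | yes y∈ | yes x∈ =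
      ih b∈ (Unique-branch uniq b∈) z∈t (¬yz ∘ from (lcaPath-node⇔branch uniq b∈ z∈t y∈))
        (¬xy ∘ from (lcaPath-node⇔branch uniq b∈ y∈ x∈)) (to (lcaPath-node⇔branch uniq b∈ z∈t x∈) xz)
    ...   | yes y∈ | no x∉  =
      ¬xy (from (lcaPath-node⇔below⁺ uniq b∈ y∈ x∉)
        (below⁺-shared {l = l} (Unique-branch uniq b∈) z∈t (to (lcaPath-node⇔below⁺ uniq b∈ z∈t x∉) xz)
          (¬yz ∘ from (lcaPath-node⇔branch uniq b∈ z∈t y∈))))

  treeNbhd-trans : ∀ {t} → Unique (leaves t) → ∀ {m x y z} → z ∈ leaves t →
                   TreeNbhd t m z y → TreeNbhd t m y x → TreeNbhd t m z x
  treeNbhd-trans _    _  (inj₁ refl) yx          = yx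
  treeNbhd-trans _    _  (inj₂ ¬yz)  (inj₁ refl) = inj₂ ¬yz
  treeNbhd-trans uniq z∈ (inj₂ ¬yz)  (inj₂ ¬xy)  = inj₂ (¬lcaPath-trans _ uniq z∈ ¬yz ¬xy)

  treeNbhd-laminar : ∀ t → Unique (leaves t) → ∀ {m y m′ y′ a b c} → y ∈ leaves t → y′ ∈ leaves t →
                     ¬ Overlap (TreeNbhd t) m y m′ y′ a b c
  treeNbhd-laminar = tree-ind P (λ { _ _ _ _ (_ , _ , _ , _ , ¬c , _) → ¬c (inj₂ λ ()) }) step
    where
    P : Tree X M → Set
    P t = Unique (leaves t) → ∀ {m y m′ y′ a b c} → y ∈ leaves t → y′ ∈ leaves t →
          ¬ Overlap (TreeNbhd t) m y m′ y′ a b c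
    step : ∀ cs → (∀ {l t} → (l , t) ∈ cs → P t) → P (node cs)
    step cs ih uniq y∈ y′∈ (a₁ , a₂ , b₁ , ¬b₂ , ¬c₁ , c₂) with leavesL⁻ cs y∈ | leavesL⁻ cs y′∈
    ... | l , t , b∈ , y∈t | l′ , t′ , b′∈ , y′∈t′
      with branch-unique uniq b∈ b′∈ (treeNbhd⊆branch uniq b∈ y∈t ¬c₁ a₁) (treeNbhd⊆branch uniq b′∈ y′∈t′ ¬b₂ a₂)
    ... | refl =
      ih b∈ (Unique-branch uniq b∈) y∈t y′∈t′
        (to (at y∈t a∈) a₁ , to (at y′∈t′ a∈) a₂ , to (at y∈t b∈t) b₁ ,
         ¬b₂ ∘ from (at y′∈t′ b∈t) , ¬c₁ ∘ from (at y∈t c∈) , to (at y′∈t′ c∈) c₂)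
      where
      at : ∀ {m y x} → y ∈ leaves t → x ∈ leaves t → TreeNbhd (node cs) m y x ⇔ TreeNbhd t m y x
      at y∈ x∈ = treeNbhd-node⇔branch uniq b∈ y∈ x∈
      a∈  = treeNbhd⊆branch uniq b∈ y∈t ¬c₁ a₁
      b∈t = treeNbhd⊆branch uniq b∈ y∈t ¬c₁ b₁
      c∈  = treeNbhd⊆branch uniq b∈ y′∈t′ ¬b₂ c₂

module _ {X M X′ M′ : Set} {N : M → X → X → Set} {N′ : M′ → X′ → X′ → Set} (f : M → M′) (g : X → X′)
         (N⇔N′ : ∀ m y x → N m y x ⇔ N′ (f m) (g y) (g x)) where

  overlap⇔ : ∀ {m y m′ y′ a b c} → Overlap N m y m′ y′ a b c ⇔ Overlap N′ (f m) (g y) (f m′) (g y′) (g a) (g b) (g c)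
  overlap⇔ {m} {y} {m′} {y′} {a} {b} {c} = mk⇔
    (λ (a₁ , a₂ , b₁ , ¬b₂ , ¬c₁ , c₂) →
       to (N⇔N′ m y a) a₁ , to (N⇔N′ m′ y′ a) a₂ , to (N⇔N′ m y b) b₁ ,
       ¬b₂ ∘ from (N⇔N′ m′ y′ b) , ¬c₁ ∘ from (N⇔N′ m y c) , to (N⇔N′ m′ y′ c) c₂)
    (λ (a₁ , a₂ , b₁ , ¬b₂ , ¬c₁ , c₂) →
       from (N⇔N′ m y a) a₁ , from (N⇔N′ m′ y′ a) a₂ , from (N⇔N′ m y b) b₁ ,
       ¬b₂ ∘ to (N⇔N′ m′ y′ b) , ¬c₁ ∘ to (N⇔N′ m y c) , from (N⇔N′ m′ y′ c) c₂)

module _ {X M : Set} (ε : X → X → Pow M) where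

  -- Nbhd m y x reads x ∈ N_m(y).
  Nbhd : M → X → X → Set
  Nbhd m y x = x ≡ y ⊎ ε x y m ≡ false

  NbhdTransitive : Set
  NbhdTransitive = ∀ m {x y z} → Nbhd m z y → Nbhd m y x → Nbhd m z x

  NbhdLaminar : Set
  NbhdLaminar = ∀ m y m′ y′ a b c → ¬ Overlap Nbhd m y m′ y′ a b c

  ε≡true⇔¬nbhd : ∀ {m x y} → x ≢ y → ε x y m ≡ true ⇔ (¬ Nbhd m y x)
  ε≡true⇔¬nbhd x≢y = mk⇔ (λ ε≡true → Sum.[ x≢y , not-¬ ε≡true ]) (λ ¬yx → ¬-not (¬yx ∘ inj₂))

  nbhd? : DecidableEquality X → ∀ m y x → Dec (Nbhd m y x)
  nbhd? _≟_ m y x = (x ≟ y) Dec.⊎-dec (ε x y m ≟ᵇ false)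

  module _ (_≟_ : DecidableEquality X) where

    -- Replacing b or a by y leaves an overlap on four points.
    overlap-on-four-points : ∀ {m y m′ y′ a b c} → Overlap Nbhd m y m′ y′ a b c →
      ∃[ p ] ∃[ q ] ∃[ a′ ] ∃[ b′ ] ∃[ c′ ]
        Overlap Nbhd m y m′ y′ a′ b′ c′ × All (_∈ y ∷ y′ ∷ p ∷ q ∷ []) (a′ ∷ b′ ∷ c′ ∷ [])
    overlap-on-four-points {m} {y} {m′} {y′} {a} {b} {c} (a₁ , a₂ , b₁ , ¬b₂ , ¬c₁ , c₂) with nbhd? _≟_ m′ y′ y
    ... | no ¬y₂ = a , c , a , y , c , (a₁ , a₂ , inj₁ refl , ¬y₂ , ¬c₁ , c₂) ,
                   there (there (here refl)) ∷ here refl ∷ there (there (there (here refl))) ∷ []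
    ... | yes y₂ = b , c , y , b , c , (inj₁ refl , y₂ , b₁ , ¬b₂ , ¬c₁ , c₂) ,
                   here refl ∷ there (there (here refl)) ∷ there (there (there (here refl))) ∷ []

  -- With a single colour, transitivity reduces an overlap to one on the three points a, y, y′.
  single-colour-laminar : (∀ (m m′ : M) → m ≡ m′) → NbhdTransitive →
    (∀ m {a y y′} → ¬ Overlap Nbhd m y m y′ a y y′) → NbhdLaminar
  single-colour-laminar one transitive three m y m′ y′ a b c (a₁ , a₂ , b₁ , ¬b₂ , ¬c₁ , c₂) with one m m′
  ... | refl =
    three m (a₁ , a₂ , inj₁ refl , (λ y₂ → ¬b₂ (transitive m y₂ b₁)) , (λ y′₁ → ¬c₁ (transitive m y′₁ c₂)) , inj₁ refl)

module _ {X M : Set} (_≟_ : DecidableEquality X) {ε : X → X → Pow M} where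

  open TreeNeighbourhoods {M = M} _≟_

  nbhd⇔treeNbhd : ∀ {T} → Explains ε T → ∀ m y x → Nbhd ε m y x ⇔ TreeNbhd T m y x
  nbhd⇔treeNbhd {T} explains m y x = mk⇔ ⇒ ⇐
    where
    ⇒ : Nbhd ε m y x → TreeNbhd T m y x
    ⇒ (inj₁ x≡y) = inj₁ x≡y
    ⇒ (inj₂ ε≡false) with x ≟ y
    ... | yes x≡y = inj₁ x≡y
    ... | no x≢y  = inj₂ (not-¬ ε≡false ∘ from (explains x y x≢y m))
    ⇐ : TreeNbhd T m y x → Nbhd ε m y x
    ⇐ (inj₁ x≡y) = inj₁ x≡y
    ⇐ (inj₂ ¬p) with x ≟ y
    ... | yes x≡y = inj₁ x≡y
    ... | no x≢y  = inj₂ (¬-not (¬p ∘ to (explains x y x≢y m)))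

  fitch⇒nbhdTransitive : IsFitch ε → NbhdTransitive ε
  fitch⇒nbhdTransitive (T , _ , all∈ , uniq , explains) m {z = z} zy yx =
    from (N⇔ m z _) (treeNbhd-trans uniq (all∈ z) (to (N⇔ m z _) zy) (to (N⇔ m _ _) yx))
    where
    N⇔ = nbhd⇔treeNbhd explains

  fitch⇒nbhdLaminar : IsFitch ε → NbhdLaminar ε
  fitch⇒nbhdLaminar (T , _ , all∈ , uniq , explains) m y m′ y′ a b c =
    treeNbhd-laminar T uniq (all∈ y) (all∈ y′) ∘ to (overlap⇔ id id (nbhd⇔treeNbhd explains))

module Construction {X M : Set} (_≟_ : DecidableEquality X)
  {xs : List X} (xs-complete : ∀ x → x ∈ xs) (xs-unique : Unique xs)
  {ms : List M} (ms-complete : ∀ m → m ∈ ms)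
  {ε : X → X → Pow M} (transitive : NbhdTransitive ε) (laminar : NbhdLaminar ε) (x₀ : X) where

  open import Data.List.Membership.DecPropositional _≟_ using (_∈?_)

  N : M → X → X → Set
  N = Nbhd ε

  N⊆ ⊆N N⊂ : M → X → List X → Set
  N⊆ m y E = ∀ {x} → N m y x → x ∈ E
  ⊆N m y E = All (N m y) E
  N⊂ m y E = N⊆ m y E × ∃[ z ] z ∈ E × ¬ N m y z

  opaque
    Nbhd? : ∀ m y x → Dec (N m y x)
    Nbhd? = nbhd? ε _≟_

    N⊆? : ∀ m y E → Dec (N⊆ m y E)
    N⊆? m y E = ∀?-complete xs-complete (λ x → Nbhd? m y x Dec.→-dec x ∈? E)

    ⊆N? : ∀ m y E → Dec (⊆N m y E)
    ⊆N? m y = All.all? (Nbhd? m y)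

    N⊂? : ∀ m y E → Dec (N⊂ m y E)
    N⊂? m y E = N⊆? m y E Dec.×-dec ∃∈? (Dec.¬? ∘ Nbhd? m y) E

  N⊆⇒⊆N⊎N⊂ : ∀ {m y E} → N⊆ m y E → ⊆N m y E ⊎ N⊂ m y E
  N⊆⇒⊆N⊎N⊂ {m} {y} {E} N⊆E with ⊆N? m y E
  ... | yes E⊆N = inj₁ E⊆N
  ... | no E⊈N  = inj₂ (N⊆E , find (Allₚ.¬All⇒Any¬ (Nbhd? m y) E E⊈N))

  ⊆⊎counterexample : ∀ m y m′ y′ → (∀ {x} → N m y x → N m′ y′ x) ⊎ ∃[ x ] N m y x × ¬ N m′ y′ x
  ⊆⊎counterexample m y m′ y′ with ∃?-complete xs-complete (λ x → Nbhd? m y x Dec.×-dec Dec.¬? (Nbhd? m′ y′ x))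
  ... | yes ∃x = inj₂ ∃x
  ... | no ∄x  = inj₁ λ {x} n → Dec.decidable-stable (Nbhd? m′ y′ x) (λ ¬n′ → ∄x (x , n , ¬n′))

  comparable : ∀ {m y m′ y′ w} → N m y w → N m′ y′ w →
               (∀ {x} → N m y x → N m′ y′ x) ⊎ (∀ {x} → N m′ y′ x → N m y x)
  comparable {m} {y} {m′} {y′} {w} w₁ w₂ with ⊆⊎counterexample m y m′ y′ | ⊆⊎counterexample m′ y′ m y
  ... | inj₁ N⊆N′           | _                   = inj₁ N⊆N′
  ... | inj₂ _              | inj₁ N′⊆N           = inj₂ N′⊆N
  ... | inj₂ (b , b₁ , ¬b₂) | inj₂ (c , c₂ , ¬c₁) = ⊥-elim (laminar m y m′ y′ w b c (w₁ , w₂ , b₁ , ¬b₂ , ¬c₁ , c₂))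

  Nested : List X → Set
  Nested E = ∀ m {y} → y ∈ E → N⊆ m y E ⊎ ⊆N m y E

  record IsBlock (ss E : List X) : Set where
    field
      ⊆ss      : ∀ {x} → x ∈ E → x ∈ ss
      outsider : ∃[ z ] z ∈ ss × z ∉ E
      N⊂⇒N⊆    : ∀ {m y} → y ∈ E → N⊂ m y ss → N⊆ m y E

  module _ {ss E : List X} (block : IsBlock ss E) where

    open IsBlock block

    N⊆⇔N⊂ : ∀ {m y} → y ∈ E → N⊆ m y E ⇔ N⊂ m y ss
    N⊆⇔N⊂ {m} {y} y∈ = mk⇔ ⇒ (N⊂⇒N⊆ y∈)
      where
      ⇒ : N⊆ m y E → N⊂ m y ss
      ⇒ N⊆E = (λ n → ⊆ss (N⊆E n)) , let z , z∈ , z∉ = outsider in z , z∈ , (λ n → z∉ (N⊆E n))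

    nested-block : Nested ss → Nested E
    nested-block nested m y∈ with nested m (⊆ss y∈)
    ... | inj₂ ss⊆N = inj₂ (All.tabulate (All.lookup ss⊆N ∘ ⊆ss))
    ... | inj₁ N⊆ss with N⊆⇒⊆N⊎N⊂ N⊆ss
    ...   | inj₁ ss⊆N = inj₂ (All.tabulate (All.lookup ss⊆N ∘ ⊆ss))
    ...   | inj₂ N⊂ss = inj₁ (N⊂⇒N⊆ y∈ N⊂ss)

    ¬nbhd⇔N⊆ : Nested ss → ∀ {m x y} → y ∈ E → x ∈ ss → x ∉ E → (¬ N m y x) ⇔ N⊆ m y E
    ¬nbhd⇔N⊆ nested {m} {x} {y} y∈ x∈ x∉ = mk⇔ ⇒ (λ N⊆E → x∉ ∘ N⊆E)
      where
      ⇒ : ¬ N m y x → N⊆ m y E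
      ⇒ ¬yx with nested m (⊆ss y∈)
      ... | inj₁ N⊆ss = N⊂⇒N⊆ y∈ (N⊆ss , x , x∈ , ¬yx)
      ... | inj₂ ss⊆N = ⊥-elim (¬yx (All.lookup ss⊆N x∈))

  GroupedWith : X → List X → X → Set
  GroupedWith a ss w = w ≡ a ⊎ ∃[ m ] ∃[ y ] N⊂ m y ss × N m y a × N m y w

  opaque
    GroupedWith? : ∀ a ss w → Dec (GroupedWith a ss w)
    GroupedWith? a ss w = (w ≟ a) Dec.⊎-dec
      ∃?-complete ms-complete (λ m → ∃?-complete xs-complete (λ y →
        N⊂? m y ss Dec.×-dec Nbhd? m y a Dec.×-dec Nbhd? m y w))

  grouped-closed : ∀ {a ss m y w z} → N⊂ m y ss → N m y w → GroupedWith a ss w → N m y z → GroupedWith a ss z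
  grouped-closed {m = m} {y} N⊂ss w∈ (inj₁ refl) z∈ = inj₂ (m , y , N⊂ss , w∈ , z∈)
  grouped-closed {m = m} {y} N⊂ss w∈ (inj₂ (m₁ , y₁ , N₁⊂ss , a∈₁ , w∈₁)) z∈ with comparable w∈ w∈₁
  ... | inj₁ N⊆N₁ = inj₂ (m₁ , y₁ , N₁⊂ss , a∈₁ , N⊆N₁ z∈)
  ... | inj₂ N₁⊆N = inj₂ (m , y , N⊂ss , N₁⊆N a∈₁ , z∈)

  -- Proper neighbourhoods around a are nested, so finitely many of them have a largest one.
  enclosing-nbhd : ∀ {a ss} → (∃[ m ] ∃[ y ] N⊂ m y ss × N m y a) → ∀ L →
                   All (λ v → ∃[ m ] ∃[ y ] N⊂ m y ss × N m y a × N m y v) L →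
                   ∃[ m ] ∃[ y ] N⊂ m y ss × N m y a × All (N m y) L
  enclosing-nbhd (m , y , N⊂ss , a∈) [] [] = m , y , N⊂ss , a∈ , []
  enclosing-nbhd start (v ∷ L) ((m₁ , y₁ , N₁⊂ss , a∈₁ , v∈₁) ∷ ws) with enclosing-nbhd start L ws
  ... | m , y , N⊂ss , a∈ , L⊆N with comparable a∈ a∈₁
  ...   | inj₁ N⊆N₁ = m₁ , y₁ , N₁⊂ss , a∈₁ , v∈₁ ∷ All.map N⊆N₁ L⊆N
  ...   | inj₂ N₁⊆N = m , y , N⊂ss , a∈ , N₁⊆N v∈₁ ∷ L⊆N

  grouped-witness : ∀ {a ss v} → (∃[ m ] ∃[ y ] N⊂ m y ss × N m y a) → GroupedWith a ss v →
                    ∃[ m ] ∃[ y ] N⊂ m y ss × N m y a × N m y v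
  grouped-witness (m , y , N⊂ss , a∈) (inj₁ refl) = m , y , N⊂ss , a∈ , a∈
  grouped-witness _                   (inj₂ w)    = w

  -- Otherwise the largest proper neighbourhood around a would contain all of ss.
  ¬all-grouped : ∀ {a b r} → a ≢ b → ¬ All (GroupedWith a (a ∷ b ∷ r)) (a ∷ b ∷ r)
  ¬all-grouped a≢b all with All.lookup all (there (here refl))
  ... | inj₁ b≡a = a≢b (sym b≡a)
  ... | inj₂ (m , y , N⊂ss , a∈ , _)
    with _ , _ , (_ , z , z∈ , ¬z) , _ , ss⊆N ←
           enclosing-nbhd (m , y , N⊂ss , a∈) _ (All.map (grouped-witness (m , y , N⊂ss , a∈)) all)
    = ¬z (All.lookup ss⊆N z∈)

  ungrouped-exists : ∀ {a b r} → a ≢ b → ∃[ w ] w ∈ a ∷ b ∷ r × ¬ GroupedWith a (a ∷ b ∷ r) w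
  ungrouped-exists a≢b = find (Allₚ.¬All⇒Any¬ (GroupedWith? _ _) _ (¬all-grouped a≢b))

  leftBlock rightBlock : X → List X → List X
  leftBlock  a ss = filter (GroupedWith? a ss) ss
  rightBlock a ss = filter (Dec.¬? ∘ GroupedWith? a ss) ss

  module _ {a b : X} {r : List X} (a≢b : a ≢ b) where

    private
      ss : List X
      ss = a ∷ b ∷ r

    left-isBlock : IsBlock ss (leftBlock a ss)
    left-isBlock = record
      { ⊆ss      = proj₁ ∘ ∈-filter⁻ (GroupedWith? a ss)
      ; outsider = let w , w∈ , ¬w = ungrouped-exists a≢b in w , w∈ , ¬w ∘ proj₂ ∘ ∈-filter⁻ (GroupedWith? a ss)
      ; N⊂⇒N⊆    = λ y∈ N⊂ss n → ∈-filter⁺ (GroupedWith? a ss) (proj₁ N⊂ss n)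
                       (grouped-closed N⊂ss (inj₁ refl) (proj₂ (∈-filter⁻ (GroupedWith? a ss) y∈)) n)
      }

    right-isBlock : IsBlock ss (rightBlock a ss)
    right-isBlock = record
      { ⊆ss      = proj₁ ∘ ∈-filter⁻ (Dec.¬? ∘ GroupedWith? a ss)
      ; outsider = a , here refl , (λ a∈ → proj₂ (∈-filter⁻ (Dec.¬? ∘ GroupedWith? a ss) a∈) (inj₁ refl))
      ; N⊂⇒N⊆    = λ y∈ N⊂ss n → ∈-filter⁺ (Dec.¬? ∘ GroupedWith? a ss) (proj₁ N⊂ss n)
                       (λ g → proj₂ (∈-filter⁻ (Dec.¬? ∘ GroupedWith? a ss) y∈) (grouped-closed N⊂ss n g (inj₁ refl)))
      }

  -- f is the fuel of build below, so it has to bound the length of the list.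
  Admissible : ℕ → List X → Set
  Admissible f E = Unique E × length E ≤ f × ∃[ w ] w ∈ E

  ¬admissible-zero : ∀ {E} → ¬ Admissible zero E
  ¬admissible-zero {[]}    (_ , _ , _ , ())
  ¬admissible-zero {_ ∷ _} (_ , () , _)

  admissible-filter : ∀ {f ss} {P : X → Set} (P? : Decidable P) → Admissible (suc f) ss →
                      (∃[ z ] z ∈ ss × ¬ P z) → (∃[ w ] w ∈ ss × P w) → Admissible f (filter P? ss)
  admissible-filter P? (uniq , len , _) (z , z∈ , ¬z) (w , w∈ , w∈P) =
    Uniqueₚ.filter⁺ P? uniq , ℕ.≤-pred (ℕ.≤-trans (filter-notAll P? _ (lose z∈ ¬z)) len) , w , ∈-filter⁺ P? w∈ w∈P

  IsNbhd : List X → M → Set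
  IsNbhd E m = ∃[ z ] z ∈ E × N⊆ m z E × ⊆N m z E

  opaque
    IsNbhd? : ∀ E m → Dec (IsNbhd E m)
    IsNbhd? E m = ∃∈? (λ z → N⊆? m z E Dec.×-dec ⊆N? m z E) E

  label : List X → Pow M
  label E m = does (IsNbhd? E m)

  -- leaf x₀ is a junk value, reached only from lists that are not admissible.
  mutual
    build : ℕ → List X → Tree X M
    build zero    _           = leaf x₀
    build (suc f) []          = leaf x₀
    build (suc f) (w ∷ [])    = leaf w
    build (suc f) (a ∷ b ∷ r) = node (children f a (a ∷ b ∷ r))

    children : ℕ → X → List X → List (Branch X M)
    children f a ss = branch f (leftBlock a ss) ∷ branch f (rightBlock a ss) ∷ []

    branch : ℕ → List X → Branch X M
    branch f E = label E , build f E

  record Block (f : ℕ) (a : X) (ss : List X) : Set where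
    field
      block      : List X
      isBlock    : IsBlock ss block
      admissible : Admissible f block
      branch∈    : branch f block ∈ children f a ss

  module _ {f : ℕ} {a b : X} {r : List X} (adm : Admissible (suc f) (a ∷ b ∷ r)) where

    private
      ss : List X
      ss = a ∷ b ∷ r
      a≢b : a ≢ b
      a≢b with (a≢b ∷ _) ∷ _ ← proj₁ adm = a≢b

    leftB : Block f a ss
    leftB = record
      { isBlock    = left-isBlock a≢b
      ; admissible = admissible-filter (GroupedWith? a ss) adm (ungrouped-exists a≢b) (a , here refl , inj₁ refl)
      ; branch∈    = here refl
      }

    rightB : Block f a ss
    rightB = record
      { isBlock    = right-isBlock a≢b
      ; admissible = admissible-filter (Dec.¬? ∘ GroupedWith? a ss) adm (a , here refl , λ ¬g → ¬g (inj₁ refl))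
                       (ungrouped-exists a≢b)
      ; branch∈    = there (here refl)
      }

    blockOf : ∀ {y} → y ∈ ss → Σ (Block f a ss) (λ B → y ∈ Block.block B)
    blockOf {y} y∈ with GroupedWith? a ss y
    ... | yes g = leftB  , ∈-filter⁺ (GroupedWith? a ss) y∈ g
    ... | no ¬g = rightB , ∈-filter⁺ (Dec.¬? ∘ GroupedWith? a ss) y∈ ¬g

    branch-block : ∀ {l t} → (l , t) ∈ children f a ss → Σ (Block f a ss) (λ B → (l , t) ≡ branch f (Block.block B))
    branch-block (here refl)         = leftB  , refl
    branch-block (there (here refl)) = rightB , refl

    blocks-disjoint : ∀ {x} → x ∈ leftBlock a ss → x ∉ rightBlock a ss
    blocks-disjoint x∈L x∈R =
      proj₂ (∈-filter⁻ (Dec.¬? ∘ GroupedWith? a ss) x∈R) (proj₂ (∈-filter⁻ (GroupedWith? a ss) x∈L))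

  leaves-build⁻ : ∀ f E → Admissible f E → ∀ {x} → x ∈ leaves (build f E) → x ∈ E
  leaves-build⁻ zero        E           adm = ⊥-elim (¬admissible-zero adm)
  leaves-build⁻ (suc f)     []          (_ , _ , _ , ())
  leaves-build⁻ (suc f)     (_ ∷ [])    _   x∈ = x∈
  leaves-build⁻ (suc f) ss@(a ∷ b ∷ r) adm x∈
    with _ , _ , b∈ , x∈t ← leavesL⁻ (children f a ss) x∈
    with B , refl ← branch-block adm b∈
    = IsBlock.⊆ss (Block.isBlock B) (leaves-build⁻ f _ (Block.admissible B) x∈t)

  leaves-build⁺ : ∀ f E → Admissible f E → ∀ {x} → x ∈ E → x ∈ leaves (build f E)
  leaves-build⁺ zero        E           adm = ⊥-elim (¬admissible-zero adm)
  leaves-build⁺ (suc f)     []          (_ , _ , _ , ())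
  leaves-build⁺ (suc f)     (_ ∷ [])    _   x∈ = x∈
  leaves-build⁺ (suc f) ss@(a ∷ b ∷ r) adm x∈
    with B , x∈B ← blockOf adm x∈
    = leavesL⁺ (Block.branch∈ B) (leaves-build⁺ f (Block.block B) (Block.admissible B) x∈B)

  Unique-leaves-build : ∀ f E → Admissible f E → Unique (leaves (build f E))
  Unique-leaves-build zero        E           adm = ⊥-elim (¬admissible-zero adm)
  Unique-leaves-build (suc f)     []          (_ , _ , _ , ())
  Unique-leaves-build (suc f)     (_ ∷ [])    _   = [] ∷ []
  Unique-leaves-build (suc f) ss@(a ∷ b ∷ r) adm =
    Uniqueₚ.++⁺ (Unique-leaves-build f _ admL) (Uniqueₚ.++⁺ (Unique-leaves-build f _ admR) [] λ ())
      (λ (x∈L , x∈R) → blocks-disjoint adm (leaves-build⁻ f _ admL x∈L)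
                         (leaves-build⁻ f _ admR (subst (_ ∈_) (++-identityʳ _) x∈R)))
    where
    admL = Block.admissible (leftB adm)
    admR = Block.admissible (rightB adm)

  phylo-build : ∀ f E → Phylo (build f E)
  phylo-build zero    _           = _
  phylo-build (suc f) []          = _
  phylo-build (suc f) (_ ∷ [])    = _
  phylo-build (suc f) (a ∷ b ∷ r) = s≤s (s≤s z≤n) , phylo-build f _ , phylo-build f _ , _

  module _ {f : ℕ} {a b : X} {r : List X} (adm : Admissible (suc f) (a ∷ b ∷ r))
           (B : Block f a (a ∷ b ∷ r)) {m : M} {y : X} (y∈B : y ∈ Block.block B) where

    open Block B

    private
      uniq : Unique (leavesL (children f a (a ∷ b ∷ r)))
      uniq = Unique-leaves-build (suc f) _ adm
      y∈leaves : y ∈ leaves (build f block)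
      y∈leaves = leaves-build⁺ f block admissible y∈B

    below-node⇔block : Below m y (build (suc f) (a ∷ b ∷ r)) ⇔ Below⁺ m y (branch f block)
    below-node⇔block = below-node⇔branch uniq branch∈ y∈leaves

    lcaPath-node⇔block : ∀ {x} → x ∈ block → LcaPath m x y (build (suc f) (a ∷ b ∷ r)) ⇔ LcaPath m x y (build f block)
    lcaPath-node⇔block x∈B = lcaPath-node⇔branch uniq branch∈ y∈leaves (leaves-build⁺ f block admissible x∈B)

    lcaPath-node⇔below⁺-block : ∀ {x} → x ∉ block → LcaPath m x y (build (suc f) (a ∷ b ∷ r)) ⇔ Below⁺ m y (branch f block)
    lcaPath-node⇔below⁺-block x∉B = lcaPath-node⇔below⁺ uniq branch∈ y∈leaves (x∉B ∘ leaves-build⁻ f block admissible)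

  mutual
    below-build⇔N⊂ : ∀ f E → Admissible f E → Nested E → ∀ {m y} → y ∈ E → Below m y (build f E) ⇔ N⊂ m y E
    below-build⇔N⊂ zero        E           adm = ⊥-elim (¬admissible-zero adm)
    below-build⇔N⊂ (suc f)     []          (_ , _ , _ , ())
    below-build⇔N⊂ (suc f)     (_ ∷ [])    _   _ (here refl) = mk⇔ (λ ()) λ { (_ , _ , here refl , ¬z) → ¬z (inj₁ refl) }
    below-build⇔N⊂ (suc f) ss@(a ∷ b ∷ r) adm nested {m} {y} y∈ with B , y∈B ← blockOf adm y∈ =
      begin
        Below m y (build (suc f) ss) ≈⟨ below-node⇔block adm B y∈B ⟩
        Below⁺ m y (branch f block)  ≈⟨ below⁺-branch⇔N⊆ f block admissible (nested-block isBlock nested) y∈B ⟩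
        N⊆ m y block                 ≈⟨ N⊆⇔N⊂ isBlock y∈B ⟩
        N⊂ m y ss                    ∎
      where
      open ⇔-Reasoning
      open Block B

    below⁺-branch⇔N⊆ : ∀ f E → Admissible f E → Nested E → ∀ {m y} → y ∈ E → Below⁺ m y (branch f E) ⇔ N⊆ m y E
    below⁺-branch⇔N⊆ f E adm nested {m} {y} y∈ = mk⇔ ⇒ ⇐
      where
      ⇒ : Below⁺ m y (branch f E) → N⊆ m y E
      ⇒ (inj₁ labelled) n =
        let z , _ , N⊆E , E⊆N = dec-true⁻ (IsNbhd? E m) labelled in N⊆E (transitive m (All.lookup E⊆N y∈) n)
      ⇒ (inj₂ below) = proj₁ (to (below-build⇔N⊂ f E adm nested y∈) below)
      ⇐ : N⊆ m y E → Below⁺ m y (branch f E)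
      ⇐ N⊆E with N⊆⇒⊆N⊎N⊂ N⊆E
      ... | inj₁ E⊆N = inj₁ (Dec.dec-true (IsNbhd? E m) (y , y∈ , N⊆E , E⊆N))
      ... | inj₂ N⊂E = inj₂ (from (below-build⇔N⊂ f E adm nested y∈) N⊂E)

  lcaPath-build⇔¬nbhd : ∀ f E → Admissible f E → Nested E → ∀ {m x y} → x ∈ E → y ∈ E → x ≢ y →
                        LcaPath m x y (build f E) ⇔ (¬ N m y x)
  lcaPath-build⇔¬nbhd zero        E           adm = ⊥-elim (¬admissible-zero adm)
  lcaPath-build⇔¬nbhd (suc f)     []          (_ , _ , _ , ())
  lcaPath-build⇔¬nbhd (suc f)     (_ ∷ [])    _   _ (here refl) (here refl) x≢y = ⊥-elim (x≢y refl)
  lcaPath-build⇔¬nbhd (suc f) ss@(a ∷ b ∷ r) adm nested {m} {x} {y} x∈ y∈ x≢y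
    with B , y∈B ← blockOf adm y∈
    with x ∈? Block.block B
  ... | yes x∈B =
    begin
      LcaPath m x y (build (suc f) ss) ≈⟨ lcaPath-node⇔block adm B y∈B x∈B ⟩
      LcaPath m x y (build f block)    ≈⟨ lcaPath-build⇔¬nbhd f block admissible (nested-block isBlock nested) x∈B y∈B x≢y ⟩
      (¬ N m y x)                      ∎
    where
    open ⇔-Reasoning
    open Block B
  ... | no x∉B =
    begin
      LcaPath m x y (build (suc f) ss) ≈⟨ lcaPath-node⇔below⁺-block adm B y∈B x∉B ⟩
      Below⁺ m y (branch f block)      ≈⟨ below⁺-branch⇔N⊆ f block admissible (nested-block isBlock nested) y∈B ⟩
      N⊆ m y block                     ≈⟨ ¬nbhd⇔N⊆ isBlock nested y∈B x∈ x∉B ⟨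
      (¬ N m y x)                      ∎
    where
    open ⇔-Reasoning
    open Block B

  fitch : IsFitch ε
  fitch = build n xs , phylo-build n xs , leaves-build⁺ n xs adm ∘ xs-complete , Unique-leaves-build n xs adm , explains
    where
    n = length xs
    adm : Admissible n xs
    adm = xs-unique , ℕ.≤-refl , x₀ , xs-complete x₀
    nested : Nested xs
    nested _ _ = inj₁ (λ {x} _ → xs-complete x)
    explains : Explains ε (build n xs)
    explains x y x≢y m =
      ⇔.trans (ε≡true⇔¬nbhd ε x≢y) (⇔.sym (lcaPath-build⇔¬nbhd n xs adm nested (xs-complete x) (xs-complete y) x≢y))

fitch⇔nbhdTransitive×laminar : ∀ {X M : Set} → DecidableEquality X →
  {xs : List X} → (∀ x → x ∈ xs) → Unique xs → {ms : List M} → (∀ m → m ∈ ms) → X →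
  (ε : X → X → Pow M) → IsFitch ε ⇔ (NbhdTransitive ε × NbhdLaminar ε)
fitch⇔nbhdTransitive×laminar _≟_ xs-complete xs-unique ms-complete x₀ ε = mk⇔
  (λ F → fitch⇒nbhdTransitive _≟_ F , fitch⇒nbhdLaminar _≟_ F)
  (λ (transitive , laminar) → Construction.fitch _≟_ xs-complete xs-unique ms-complete transitive laminar x₀)

module _ {n : ℕ} {s : Subset n} where

  Elem-≡ : ∀ {x y} {x∈ : x ∈ₛ s} {y∈ : y ∈ₛ s} → x ≡ y → _≡_ {A = Elem s} (x , x∈) (y , y∈)
  Elem-≡ {x∈ = x∈} {y∈} refl = cong (_ ,_) ([]=-irrelevant x∈ y∈)

  _≟ᴱ_ : DecidableEquality (Elem s)
  (x , _) ≟ᴱ (y , _) = Dec.map′ Elem-≡ (cong proj₁) (x Fin.≟ y)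

sucᴱ : ∀ {n b} {s : Subset n} → Elem s → Elem (b ∷ s)
sucᴱ (x , x∈) = suc x , there x∈

sucᴱ-injective : ∀ {n b} {s : Subset n} {e e′ : Elem s} → sucᴱ {b = b} e ≡ sucᴱ e′ → e ≡ e′
sucᴱ-injective eq = Elem-≡ (Fin.suc-injective (cong proj₁ eq))

elems : ∀ {n} (s : Subset n) → List (Elem s)
elems []            = []
elems (inside ∷ s)  = (zero , here) ∷ List.map sucᴱ (elems s)
elems (outside ∷ s) = List.map sucᴱ (elems s)

elems-complete : ∀ {n} (s : Subset n) (e : Elem s) → e ∈ elems s
elems-complete (inside ∷ s)  (zero , here)      = here refl
elems-complete (inside ∷ s)  (suc x , there x∈) = there (∈-map⁺ sucᴱ (elems-complete s (x , x∈)))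
elems-complete (outside ∷ s) (suc x , there x∈) = ∈-map⁺ sucᴱ (elems-complete s (x , x∈))

elems-unique : ∀ {n} (s : Subset n) → Unique (elems s)
elems-unique []            = []
elems-unique (inside ∷ s)  = Allₚ.map⁺ (All.tabulate (λ _ → Fin.0≢1+n ∘ cong proj₁)) ∷ Uniqueₚ.map⁺ sucᴱ-injective (elems-unique s)
elems-unique (outside ∷ s) = Uniqueₚ.map⁺ sucᴱ-injective (elems-unique s)

nonempty-elem : ∀ {n j} (s : Subset n) → ∣ s ∣ ≡ suc j → Elem s
nonempty-elem (inside ∷ s)  _      = zero , here
nonempty-elem (outside ∷ s) ∣s∣≡1+j = sucᴱ (nonempty-elem s ∣s∣≡1+j)

∣p∪q∣≤∣p∣+∣q∣ : ∀ {n} (p q : Subset n) → ∣ p ∪ q ∣ ≤ ∣ p ∣ + ∣ q ∣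
∣p∪q∣≤∣p∣+∣q∣ []            []            = z≤n
∣p∪q∣≤∣p∣+∣q∣ (inside ∷ p)  (inside ∷ q)  = s≤s (ℕ.≤-trans (∣p∪q∣≤∣p∣+∣q∣ p q) (ℕ.≤-trans (ℕ.n≤1+n _) (ℕ.≤-reflexive (sym (ℕ.+-suc _ _)))))
∣p∪q∣≤∣p∣+∣q∣ (inside ∷ p)  (outside ∷ q) = s≤s (∣p∪q∣≤∣p∣+∣q∣ p q)
∣p∪q∣≤∣p∣+∣q∣ (outside ∷ p) (inside ∷ q)  = ℕ.≤-trans (s≤s (∣p∪q∣≤∣p∣+∣q∣ p q)) (ℕ.≤-reflexive (sym (ℕ.+-suc _ _)))
∣p∪q∣≤∣p∣+∣q∣ (outside ∷ p) (outside ∷ q) = ∣p∪q∣≤∣p∣+∣q∣ p q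

points : ∀ {n} → List (Fin n) → Subset n
points = List.foldr (λ x p → ⁅ x ⁆ ∪ p) ∅

∣points∣≤length : ∀ {n} (L : List (Fin n)) → ∣ points L ∣ ≤ length L
∣points∣≤length {n} []      = ℕ.≤-reflexive (∣⊥∣≡0 n)
∣points∣≤length     (x ∷ L) = ℕ.≤-trans (∣p∪q∣≤∣p∣+∣q∣ ⁅ x ⁆ (points L))
  (ℕ.≤-trans (ℕ.≤-reflexive (cong (_+ _) (∣⁅x⁆∣≡1 x))) (s≤s (∣points∣≤length L)))

∈-points : ∀ {n} (L : List (Fin n)) → All (_∈ₛ points L) L
∈-points []      = []
∈-points (x ∷ L) = p⊆p∪q (points L) (x∈⁅x⁆ x) ∷ All.map (q⊆p∪q ⁅ x ⁆ (points L)) (∈-points L)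

extend : ∀ {n} (p : Subset n) k → ∣ p ∣ ≤ k → k ≤ n → ∃[ s ] ∣ s ∣ ≡ k × p ⊆ s
extend []            zero    _        _         = [] , refl , id
extend (inside ∷ p)  (suc k) (s≤s le) (s≤s k≤n) = let s , ∣s∣≡k , p⊆s = extend p k le k≤n in inside ∷ s , cong suc ∣s∣≡k , in⊆in p⊆s
extend {suc n} (outside ∷ p) k le k≤1+n with k ℕ.≤? n
... | yes k≤n = let s , ∣s∣≡k , p⊆s = extend p k le k≤n in outside ∷ s , ∣s∣≡k , out⊆ p⊆s
... | no  k≰n = ⊤ , trans (∣⊤∣≡n (suc n)) (ℕ.≤-antisym (ℕ.≰⇒> k≰n) k≤1+n) , ⊆⊤

cover : ∀ {n} k (L : List (Fin n)) → length L ≤ k → k ≤ n → ∃[ s ] ∣ s ∣ ≡ k × All (_∈ₛ s) L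
cover k L len k≤n =
  let s , ∣s∣≡k , points⊆s = extend (points L) k (ℕ.≤-trans (∣points∣≤length L) len) k≤n in
  s , ∣s∣≡k , All.map points⊆s (∈-points L)

three-distinct⇒3≤ : ∀ {n} {x y z : Fin n} → x ≢ y → y ≢ z → x ≢ z → 3 ≤ n
three-distinct⇒3≤ {n} {x} {y} {z} x≢y y≢z x≢z with 3 ℕ.≤? n
... | yes 3≤n = 3≤n
... | no  3≰n with Fin.pigeonhole (ℕ.≰⇒> 3≰n) (λ { zero → x ; (suc zero) → y ; (suc (suc zero)) → z })
...   | zero           , suc zero       , _            , x≡y = ⊥-elim (x≢y x≡y)
...   | zero           , suc (suc zero) , _            , x≡z = ⊥-elim (x≢z x≡z)
...   | suc zero       , suc (suc zero) , _            , y≡z = ⊥-elim (y≢z y≡z)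
...   | zero           , zero           , ()           , _
...   | suc zero       , zero           , ()           , _
...   | suc zero       , suc zero       , s≤s ()       , _
...   | suc (suc zero) , zero           , ()           , _
...   | suc (suc zero) , suc zero       , s≤s ()       , _
...   | suc (suc zero) , suc (suc zero) , s≤s (s≤s ()) , _

module _ {n k : ℕ} {X′ : Subset n} {M′ : Subset k} (ε : Fin n → Fin n → Pow (Fin k)) where

  nbhd-restrict⇔ : ∀ m y x → Nbhd (restrict X′ M′ ε) m y x ⇔ Nbhd ε (proj₁ m) (proj₁ y) (proj₁ x)
  nbhd-restrict⇔ _ _ _ = mk⇔ (Sum.map₁ (cong proj₁)) (Sum.map₁ Elem-≡)

  fitch⇒fitch-restrict : Elem X′ → IsFitch ε → IsFitch (restrict X′ M′ ε)
  fitch⇒fitch-restrict x₀ F =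
    from (fitch⇔nbhdTransitive×laminar _≟ᴱ_ (elems-complete X′) (elems-unique X′) (elems-complete M′) x₀ _)
         (transitive′ , laminar′)
    where
    N⇔ = nbhd-restrict⇔
    transitive′ : NbhdTransitive (restrict X′ M′ ε)
    transitive′ m {x} {y} {z} zy yx =
      from (N⇔ m z x) (fitch⇒nbhdTransitive Fin._≟_ F (proj₁ m) (to (N⇔ m z y) zy) (to (N⇔ m y x) yx))
    laminar′ : NbhdLaminar (restrict X′ M′ ε)
    laminar′ m y m′ y′ a b c ov =
      fitch⇒nbhdLaminar Fin._≟_ F _ _ _ _ _ _ _ (to (overlap⇔ proj₁ proj₁ N⇔ {m} {y} {m′} {y′} {a} {b} {c}) ov)

  module _ (F : IsFitch (restrict X′ M′ ε)) where

    transitive-within : ∀ {m x y z} → m ∈ₛ M′ → x ∈ₛ X′ → y ∈ₛ X′ → z ∈ₛ X′ →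
                        Nbhd ε m z y → Nbhd ε m y x → Nbhd ε m z x
    transitive-within m∈ x∈ y∈ z∈ zy yx =
      to (nbhd-restrict⇔ m z x) (fitch⇒nbhdTransitive _≟ᴱ_ F m (from (nbhd-restrict⇔ m z y) zy) (from (nbhd-restrict⇔ m y x) yx))
      where
      m = _ , m∈
      x = _ , x∈
      y = _ , y∈
      z = _ , z∈

    laminar-within : ∀ {m m′ y y′ a b c} → m ∈ₛ M′ → m′ ∈ₛ M′ → y ∈ₛ X′ → y′ ∈ₛ X′ → a ∈ₛ X′ → b ∈ₛ X′ → c ∈ₛ X′ →
                     ¬ Overlap (Nbhd ε) m y m′ y′ a b c
    laminar-within m∈ m′∈ y∈ y′∈ a∈ b∈ c∈ ov =
      fitch⇒nbhdLaminar _≟ᴱ_ F m y m′ y′ a b c (from (overlap⇔ proj₁ proj₁ nbhd-restrict⇔ {m} {y} {m′} {y′} {a} {b} {c}) ov)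
      where
      m = _ , m∈
      m′ = _ , m′∈
      y = _ , y∈
      y′ = _ , y′∈
      a = _ , a∈
      b = _ , b∈
      c = _ , c∈

module _ {n k : ℕ} (ε : Fin (suc n) → Fin (suc n) → Pow (Fin (suc k))) where

  FitchCover : List (Fin (suc n)) → List (Fin (suc k)) → Set
  FitchCover L C = ∃[ X′ ] ∃[ M′ ] IsFitch (restrict X′ M′ ε) × All (_∈ₛ X′) L × All (_∈ₛ M′) C

  transitive-from-covers : (∀ m {x y z} → x ≢ y → y ≢ z → x ≢ z → FitchCover (x ∷ y ∷ z ∷ []) [ m ]) →
                           NbhdTransitive ε
  transitive-from-covers covers m {x} {y} {z} zy yx with x Fin.≟ y | y Fin.≟ z | x Fin.≟ z
  ... | yes refl | _        | _        = zy
  ... | no _     | yes refl | _        = yx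
  ... | no _     | no _     | yes refl = inj₁ refl
  ... | no x≢y   | no y≢z   | no x≢z with covers m x≢y y≢z x≢z
  ...   | _ , _ , F , x∈ ∷ y∈ ∷ z∈ ∷ [] , m∈ ∷ [] = transitive-within ε F m∈ x∈ y∈ z∈ zy yx

  laminar-from-covers : (∀ m m′ y y′ p q → FitchCover (y ∷ y′ ∷ p ∷ q ∷ []) (m ∷ m′ ∷ [])) → NbhdLaminar ε
  laminar-from-covers covers m y m′ y′ a b c ov
    with p , q , a′ , b′ , c′ , ov′ , a′∈ ∷ b′∈ ∷ c′∈ ∷ [] ← overlap-on-four-points ε Fin._≟_ ov
    with _ , _ , F , X′∋ , m∈ ∷ m′∈ ∷ [] ← covers m m′ y y′ p q
    = laminar-within ε F m∈ m′∈ (All.lookup X′∋ (here refl)) (All.lookup X′∋ (there (here refl)))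
        (All.lookup X′∋ a′∈) (All.lookup X′∋ b′∈) (All.lookup X′∋ c′∈) ov′

  FourPointCondition SmallCondition SingleColourCondition : Set
  FourPointCondition    = 2 ≤ suc k → 4 ≤ suc n → ∀ X′ M′ → ∣ X′ ∣ ≡ 4 → ∣ M′ ∣ ≡ 2 → IsFitch (restrict X′ M′ ε)
  SmallCondition        = 2 ≤ suc k → suc n ≤ 3 → ∀ M′ → ∣ M′ ∣ ≡ 2 → IsFitch (restrict ⊤ M′ ε)
  SingleColourCondition = suc k ≡ 1 → ∀ X′ → ∣ X′ ∣ ≡ 3 → IsFitch (restrict X′ ⊤ ε)

  covers-two-colours : 2 ≤ suc k → FourPointCondition → SmallCondition →
                       ∀ L C → length L ≤ 4 → length C ≤ 2 → FitchCover L C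
  covers-two-colours 2≤1+k four small L C ∣L∣≤4 ∣C∣≤2 with cover 2 C ∣C∣≤2 2≤1+k | 4 ℕ.≤? suc n
  ... | M′ , ∣M′∣≡2 , C⊆M′ | yes 4≤1+n =
    let X′ , ∣X′∣≡4 , L⊆X′ = cover 4 L ∣L∣≤4 4≤1+n in
    X′ , M′ , four 2≤1+k 4≤1+n X′ M′ ∣X′∣≡4 ∣M′∣≡2 , L⊆X′ , C⊆M′
  ... | M′ , ∣M′∣≡2 , C⊆M′ | no 4≰1+n =
    ⊤ , M′ , small 2≤1+k (ℕ.≤-pred (ℕ.≰⇒> 4≰1+n)) M′ ∣M′∣≡2 , All.tabulate (λ _ → ∈⊤) , C⊆M′

  covers-one-colour : SingleColourCondition → suc k ≡ 1 →
                      ∀ m {x y z} → x ≢ y → y ≢ z → x ≢ z → FitchCover (x ∷ y ∷ z ∷ []) [ m ]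
  covers-one-colour single 1+k≡1 m x≢y y≢z x≢z =
    let X′ , ∣X′∣≡3 , L⊆X′ = cover 3 _ ℕ.≤-refl (three-distinct⇒3≤ x≢y y≢z x≢z) in
    X′ , ⊤ , single 1+k≡1 X′ ∣X′∣≡3 , L⊆X′ , ∈⊤ ∷ []

nbhd-from-conditions : ∀ {n} k (ε : Fin (suc n) → Fin (suc n) → Pow (Fin (suc k))) →
  FourPointCondition ε → SmallCondition ε → SingleColourCondition ε → NbhdTransitive ε × NbhdLaminar ε
nbhd-from-conditions zero ε _ _ single = transitive , single-colour-laminar ε one transitive three
  where
  covers = covers-one-colour ε single refl
  transitive = transitive-from-covers ε covers
  one : (m m′ : Fin 1) → m ≡ m′
  one zero zero = refl
  three : ∀ m {a y y′} → ¬ Overlap (Nbhd ε) m y m y′ a y y′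
  three m ov@(a₁ , a₂ , _ , ¬y₂ , ¬y′₁ , _)
    with _ , _ , F , a∈ ∷ y∈ ∷ y′∈ ∷ [] , m∈ ∷ [] ←
           covers m (λ { refl → ¬y₂ a₂ }) (λ { refl → ¬y₂ (inj₁ refl) }) (λ { refl → ¬y′₁ a₁ })
    = laminar-within ε F m∈ m∈ y∈ y′∈ a∈ y∈ y′∈ ov
nbhd-from-conditions (suc k) ε four small _ =
  transitive-from-covers ε (λ m _ _ _ → covers _ [ m ] (s≤s (s≤s (s≤s z≤n))) (s≤s z≤n)) ,
  laminar-from-covers ε (λ m m′ y y′ p q → covers _ _ ℕ.≤-refl ℕ.≤-refl)
  where
  covers = covers-two-colours ε (s≤s (s≤s z≤n)) four small

corollary3 : (n k : ℕ) (ε : Fin (suc n) → Fin (suc n) → Pow (Fin (suc k))) →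
    IsFitch ε ⇔
      ( (2 ≤ suc k → 4 ≤ suc n →
           ∀ (X' : Subset (suc n)) (M' : Subset (suc k)) → ∣ X' ∣ ≡ 4 → ∣ M' ∣ ≡ 2 →
           IsFitch (restrict X' M' ε))
      × (2 ≤ suc k → suc n ≤ 3 →
           ∀ (M' : Subset (suc k)) → ∣ M' ∣ ≡ 2 →
           IsFitch (restrict ⊤ M' ε))
      × (suc k ≡ 1 →
           ∀ (X' : Subset (suc n)) → ∣ X' ∣ ≡ 3 →
           IsFitch (restrict X' ⊤ ε)) )
corollary3 n k ε = mk⇔
  (λ F → (λ _ _ X′ _ ∣X′∣≡4 _ → fitch⇒fitch-restrict ε (nonempty-elem X′ ∣X′∣≡4) F)
       , (λ _ _ _ _ → fitch⇒fitch-restrict ε (zero , ∈⊤) F)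
       , (λ _ X′ ∣X′∣≡3 → fitch⇒fitch-restrict ε (nonempty-elem X′ ∣X′∣≡3) F))
  (λ (four , small , single) →
     from (fitch⇔nbhdTransitive×laminar Fin._≟_ ∈-allFin (Uniqueₚ.allFin⁺ (suc n)) ∈-allFin zero ε)
          (nbhd-from-conditions k ε four small single))
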